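{- Let $\lambda\vdash n$ with $\lambda'=(s,r)$, $s\ge r\ge1$, and let $0\le\Delta<r$. Let $\pi$ be a minimal permutation of shape $\lambda$ and let $J$ be a jump partition for $\pi$ of size $\Delta$ that is valid for $\pi$. Then $J(\pi)\in W_\lambda^\Delta$.
   Context: For $\sigma\in S_n$, $\mathrm{inv}(\sigma)$ is its number of inversions and $\mathrm{sh}(\sigma)$ its Robinson–Schensted shape; $\lambda'$ is the conjugate of $\lambda$. $W_\lambda^\Delta$ is the set of permutations of shape $\lambda$ with exactly $\Delta$ more inversions than the minimum over permutations of shape $\lambda$. A minimal permutation of shape $\lambda$ is one attaining this minimum; for $\lambda'=(s,r)$ these are exactly $(c_1,c_1-1,\dots,1,\,n,\dots,c_1+1)$ (one-line notation) with $(c_1,c_2)\in\{(s,r),(r,s)\}$, $n=s+r$. For such $\pi$: $s_t$ is the adjacent transposition $(t\ t{+}1)$; $\sigma\cdot s_t$ swaps the entries at positions $t,t+1$ of $\sigma$, and $s_t\cdot\sigma$ swaps the values $t,t+1$; products act successively (left to right for right multiplication, rightmost first for left multiplication). An inner (resp. outer) jump partition is an integer partition $\mu$ (resp. $\nu$), possibly empty, with $\ell(\mu)\le c_1$, $\mu_1<c_2$ (resp. $\ell(\nu)\le c_1$, $\nu_1<c_2$). Actions: $\pi\circ\mu=\pi\cdot\prod_{j=1}^{\ell(\mu)}(s_{c_1-j+1}s_{c_1-j+2}\cdots s_{c_1-j+\mu_j})$ (factors in order $j=1,2,\dots$ left to right), and $\nu\circ\pi=F_{\ell(\nu)}\cdots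 F_1\cdot\pi$ with $F_j=s_{c_1-j+\nu_j}\cdots s_{c_1-j+2}s_{c_1-j+1}$. A jump partition is a pair $J=(\mu,\nu)$ of size $|\mu|+|\nu|$, with $J(\pi)=\nu\circ(\pi\circ\mu)$; it is valid for $\pi$ if $\mathrm{sh}(J(\pi))=\mathrm{sh}(\pi)$. -}

module Defs where

open import Data.Nat using (ℕ; zero; suc; _+_; _∸_; _≤_; _<_; _≥_; _≡ᵇ_; _<ᵇ_)
open import Data.Bool using (Bool; true; false; if_then_else_)
open import Data.List using (List; []; _∷_; _++_; length; map; foldl; upTo)
open import Data.Nat.ListAction using (sum)
open import Data.List.Relation.Unary.All using (All)
open import Data.List.Relation.Unary.Linked using (Linked)
open import Data.List.Relation.Binary.Permutation.Propositional using (_↭_)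
open import Data.Maybe using (Maybe; just; nothing)
open import Data.Product using (Σ; _×_; _,_)
open import Data.Unit using (⊤)
open import Relation.Binary.PropositionalEquality using (_≡_)

IsPerm : ℕ → List ℕ → Set
IsPerm n σ = σ ↭ map suc (upTo n)

countLess : ℕ → List ℕ → ℕ
countLess x [] = 0
countLess x (y ∷ ys) = (if y <ᵇ x then 1 else 0) + countLess x ys

inv : List ℕ → ℕ
inv [] = 0
inv (x ∷ xs) = countLess x xs + inv xs

bump : ℕ → List ℕ → List ℕ × Maybe ℕ
bump x [] = x ∷ [] , nothing
bump x (y ∷ ys) with x <ᵇ y
... | true = x ∷ ys , just y
... | false with bump x ys
...   | ys' , m = y ∷ ys' , m

rowInsert : ℕ → List (List ℕ) → List (List ℕ)
rowInsert x [] = (x ∷ []) ∷ []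
rowInsert x (row ∷ rows) with bump x row
... | row' , nothing = row' ∷ rows
... | row' , just y = row' ∷ rowInsert y rows

PTableau : List ℕ → List (List ℕ)
PTableau σ = foldl (λ T x → rowInsert x T) [] σ

sh : List ℕ → List ℕ
sh σ = map length (PTableau σ)

IsPartition : List ℕ → Set
IsPartition λ' = Linked _≥_ λ' × All (λ k → 1 ≤ k) λ'

IsPartitionOf : ℕ → List ℕ → Set
IsPartitionOf n λ' = IsPartition λ' × sum λ' ≡ n

countGe : ℕ → List ℕ → ℕ
countGe i [] = 0
countGe i (x ∷ xs) = (if x <ᵇ i then 0 else 1) + countGe i xs

headOr0 : List ℕ → ℕ
headOr0 [] = 0
headOr0 (x ∷ _) = x

conjFrom : ℕ → ℕ → List ℕ → List ℕ
conjFrom i zero λ' = []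
conjFrom i (suc k) λ' = countGe i λ' ∷ conjFrom (suc i) k λ'

conj : List ℕ → List ℕ
conj λ' = conjFrom 1 (headOr0 λ') λ'

IsMinInv : ℕ → List ℕ → ℕ → Set
IsMinInv n λ' m =
  Σ (List ℕ) (λ σ → IsPerm n σ × sh σ ≡ λ' × inv σ ≡ m)
  × (∀ σ → IsPerm n σ → sh σ ≡ λ' → m ≤ inv σ)

InW : ℕ → List ℕ → ℕ → List ℕ → Set
InW n λ' Δ τ =
  IsPerm n τ × sh τ ≡ λ'
  × Σ ℕ (λ m → IsMinInv n λ' m × inv τ ≡ m + Δ)

desc : ℕ → ℕ → List ℕ
desc a zero = []
desc a (suc k) = (a + suc k) ∷ desc a k

minPerm : ℕ → ℕ → List ℕ
minPerm c1 c2 = desc 0 c1 ++ desc c1 c2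

-- σ · s_t : swap the entries at positions t, t+1 (1-indexed)
swapPos : ℕ → List ℕ → List ℕ
swapPos (suc zero) (a ∷ b ∷ xs) = b ∷ a ∷ xs
swapPos (suc (suc k)) (x ∷ xs) = x ∷ swapPos (suc k) xs
swapPos _ xs = xs

-- s_t · σ : swap the values t, t+1
swapVal : ℕ → List ℕ → List ℕ
swapVal t = map (λ x → if x ≡ᵇ t then suc t else (if x ≡ᵇ suc t then t else x))

applyAll : (ℕ → List ℕ → List ℕ) → List ℕ → List ℕ → List ℕ
applyAll f [] σ = σ
applyAll f (t ∷ ts) σ = applyAll f ts (f t σ)

run : ℕ → ℕ → ℕ → List ℕ
run c1 j m = map (λ k → (c1 ∸ j) + suc k) (upTo m)

jumpWord : ℕ → ℕ → List ℕ → List ℕ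
jumpWord c1 j [] = []
jumpWord c1 j (m ∷ ms) = run c1 j m ++ jumpWord c1 (suc j) ms

-- π ∘ μ = π · ∏_j (s_{c1-j+1} ⋯ s_{c1-j+μ_j}) : right multiplications applied left to right
innerAct : ℕ → List ℕ → List ℕ → List ℕ
innerAct c1 σ μ = applyAll swapPos (jumpWord c1 1 μ) σ

-- ν ∘ π = F_ℓ ⋯ F_1 · π, F_j = s_{c1-j+ν_j} ⋯ s_{c1-j+1}:
-- left multiplications applied rightmost first, i.e. F_1 first and inside
-- F_j the factor s_{c1-j+1} first.
outerAct : ℕ → List ℕ → List ℕ → List ℕ
outerAct c1 ν σ = applyAll swapVal (jumpWord c1 1 ν) σ

headLt : List ℕ → ℕ → Set
headLt [] c = ⊤
headLt (x ∷ _) c = x < c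

IsJumpPartition : ℕ → ℕ → List ℕ → Set
IsJumpPartition c1 c2 μ = IsPartition μ × length μ ≤ c1 × headLt μ c2

applyJump : ℕ → List ℕ → List ℕ → List ℕ → List ℕ
applyJump c1 μ ν π = outerAct c1 ν (innerAct c1 π μ)

-- Every permutation σ has at least n(sh σ) = Σᵢ (i − 1) λᵢ inversions: row insertion of x
-- creates a box in row i + 1 only after i bumps, each displacing a distinct earlier entry
-- greater than x. The minimal permutation π = (c₁, …, 1, n, …, c₁ + 1) has the two-column
-- insertion tableau and inv π = n(λ), so it attains this bound. The inner action π ∘ μ slides
-- the entry j of the block c₁ … 1 to the right past μⱼ entries of the block n … c₁ + 1, and the
-- outer action raises the value c₁ − j + 1 by νⱼ, always swapping it with a larger value lying
-- to its right; each of these |J| adjacent transpositions creates exactly one inversion. Since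
-- ℓ(μ) + ℓ(ν) ≤ |J| < r ≤ c₁, the two actions move disjoint entries of the first block, so
-- inv J(π) = inv π + Δ, and validity of J keeps the shape λ.

module Submission where

open import Defs
open import Data.Nat
open import Data.Nat.Properties
open import Data.Nat.ListAction using (sum)
open import Relation.Binary.PropositionalEquality hiding ([_])
open import Data.Bool using (Bool; true; false; if_then_else_; T)
open import Data.List using (List; []; _∷_; _++_; [_]; _∷ʳ_; length; map; foldl; concat; replicate; upTo; applyUpTo; take; drop)
open import Data.List.Properties using (++-assoc; ++-identityʳ; foldl-++; map-upTo; map-id-local; map-++; length-++; length-take; take++drop≡id)
open import Data.Maybe using (Maybe; just; nothing)
open import Data.Product using (Σ; _×_; _,_; proj₁; proj₂)
open import Data.Sum using (_⊎_; inj₁; inj₂; [_,_]′)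
open import Function using (_∘_)
open import Data.List.Relation.Unary.All as All using (All; []; _∷_)
import Data.List.Relation.Unary.All.Properties as AllP
open import Data.List.Relation.Unary.Linked as Linked using (Linked; []; [-]; _∷_)
open import Data.List.Relation.Unary.Linked.Properties using (Linked⇒All)
open import Data.List.Relation.Unary.Unique.Propositional using (Unique)
import Data.List.Relation.Unary.Unique.Propositional.Properties as UniqueP
open import Data.List.Relation.Binary.Permutation.Propositional
  using (_↭_; prep; swap; ↭-refl; ↭-sym; ↭-trans; ↭-reflexive; module PermutationReasoning; ↭⇒↭ₛ)
open import Data.List.Relation.Binary.Permutation.Propositional.Properties using (∷↭∷ʳ; ++⁺; ∈-resp-↭)
import Data.List.Relation.Binary.Permutation.Propositional.Properties as Perm
open import Data.List.Relation.Binary.Permutation.Setoid.Properties (setoid ℕ) using (Unique-resp-↭)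
open import Data.List.Membership.Propositional using (_∈_)
open import Data.List.Membership.Propositional.Properties using (∈-map⁺; ∈-upTo⁺; ∈-++⁺ˡ; ∈-++⁺ʳ; ∈-++⁻)
open import Data.List.Relation.Unary.AllPairs using ([]; _∷_)
open import Data.List.Relation.Unary.Any using (here; there)
open import Relation.Nullary using (contradiction; yes; no)
open import Algebra.Properties.CommutativeSemigroup +-commutativeSemigroup
  using (interchange; x∙yz≈y∙xz; xy∙z≈xz∙y; xy∙z≈zy∙x)

-- Counting inversions

indicator : Bool → ℕ
indicator b = if b then 1 else 0

<⇒<ᵇ≡true : ∀ {x y} → x < y → (x <ᵇ y) ≡ true
<⇒<ᵇ≡true {x} {y} x<y with x <ᵇ y | <⇒<ᵇ x<y
... | true | _ = refl

≥⇒<ᵇ≡false : ∀ {x y} → y ≤ x → (x <ᵇ y) ≡ false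
≥⇒<ᵇ≡false {x} {y} y≤x with x <ᵇ y in eq
... | false = refl
... | true = contradiction (<ᵇ⇒< x y (subst T (sym eq) _)) (≤⇒≯ y≤x)

countGreater : ℕ → List ℕ → ℕ
countGreater x [] = 0
countGreater x (y ∷ ys) = indicator (x <ᵇ y) + countGreater x ys

countLess-++ : ∀ x xs ys → countLess x (xs ++ ys) ≡ countLess x xs + countLess x ys
countLess-++ x [] ys = refl
countLess-++ x (y ∷ xs) ys =
  trans (cong (indicator (y <ᵇ x) +_) (countLess-++ x xs ys)) (sym (+-assoc (indicator (y <ᵇ x)) (countLess x xs) _))

countGreater-++ : ∀ x xs ys → countGreater x (xs ++ ys) ≡ countGreater x xs + countGreater x ys
countGreater-++ x [] ys = refl
countGreater-++ x (y ∷ xs) ys =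
  trans (cong (indicator (x <ᵇ y) +_) (countGreater-++ x xs ys)) (sym (+-assoc (indicator (x <ᵇ y)) (countGreater x xs) _))

countGreater-antitone : ∀ {x y} zs → x ≤ y → countGreater y zs ≤ countGreater x zs
countGreater-antitone [] _ = z≤n
countGreater-antitone {x} {y} (z ∷ zs) x≤y =
  +-mono-≤ indicator-antitone (countGreater-antitone zs x≤y)
  where
    indicator-antitone : indicator (y <ᵇ z) ≤ indicator (x <ᵇ z)
    indicator-antitone with y <ᵇ z in eq
    ... | false = z≤n
    ... | true rewrite <⇒<ᵇ≡true (≤-<-trans x≤y (<ᵇ⇒< y z (subst T (sym eq) _))) = ≤-refl

countLess-none : ∀ x L → All (x <_) L → countLess x L ≡ 0
countLess-none x [] [] = refl
countLess-none x (y ∷ L) (x<y ∷ above) rewrite ≥⇒<ᵇ≡false (<⇒≤ x<y) = countLess-none x L above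

countLess-all : ∀ x L → All (_< x) L → countLess x L ≡ length L
countLess-all x [] [] = refl
countLess-all x (y ∷ L) (y<x ∷ below) rewrite <⇒<ᵇ≡true y<x = cong suc (countLess-all x L below)

inv-∷ʳ : ∀ xs x → inv (xs ++ [ x ]) ≡ inv xs + countGreater x xs
inv-∷ʳ [] x = refl
inv-∷ʳ (y ∷ xs) x = begin
  countLess y (xs ++ [ x ]) + inv (xs ++ [ x ])
    ≡⟨ cong₂ _+_ (countLess-++ y xs [ x ]) (inv-∷ʳ xs x) ⟩
  (countLess y xs + (indicator (x <ᵇ y) + 0)) + (inv xs + countGreater x xs)
    ≡⟨ cong (λ k → (countLess y xs + k) + _) (+-identityʳ _) ⟩
  (countLess y xs + indicator (x <ᵇ y)) + (inv xs + countGreater x xs)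
    ≡⟨ interchange (countLess y xs) _ _ _ ⟩
  (countLess y xs + inv xs) + (indicator (x <ᵇ y) + countGreater x xs) ∎
  where open ≡-Reasoning

inv-++-increasing : ∀ xs ys → All (λ x → All (x <_) ys) xs → inv (xs ++ ys) ≡ inv xs + inv ys
inv-++-increasing [] ys _ = refl
inv-++-increasing (x ∷ xs) ys (x<ys ∷ xs<ys)
  rewrite countLess-++ x xs ys | countLess-none x ys x<ys | inv-++-increasing xs ys xs<ys
        | +-identityʳ (countLess x xs) = sym (+-assoc (countLess x xs) (inv xs) (inv ys))

-- Row insertion and the bound n(sh σ) ≤ inv σ

-- n(λ) = Σᵢ (i − 1) λᵢ
nStat : List ℕ → ℕ
nStat [] = 0
nStat (a ∷ as) = nStat as + sum as

data BumpSpec (x : ℕ) (row : List ℕ) : List ℕ × Maybe ℕ → Set where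
  appended : ∀ row′ → length row′ ≡ suc (length row)
    → (∀ z → countGreater z row′ ≡ countGreater z row + indicator (z <ᵇ x))
    → BumpSpec x row (row′ , nothing)
  bumped : ∀ row′ y → length row′ ≡ length row → x < y → 1 ≤ countGreater x row
    → (∀ z → countGreater z row′ + indicator (z <ᵇ y) ≡ countGreater z row + indicator (z <ᵇ x))
    → BumpSpec x row (row′ , just y)

bump-spec : ∀ x row → BumpSpec x row (bump x row)
bump-spec x [] = appended [ x ] refl (λ _ → +-identityʳ _)
bump-spec x (y ∷ ys) with x <ᵇ y in eq
... | true = bumped (x ∷ ys) y refl (<ᵇ⇒< x y (subst T (sym eq) _))
  (subst (λ b → 1 ≤ indicator b + countGreater x ys) (sym eq) (s≤s z≤n))
  (λ z → xy∙z≈zy∙x (indicator (z <ᵇ x)) _ _)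
... | false with bump x ys | bump-spec x ys
...   | _ | appended row′ len count = appended (y ∷ row′) (cong suc len)
  (λ z → trans (cong (indicator (z <ᵇ y) +_) (count z)) (sym (+-assoc (indicator (z <ᵇ y)) (countGreater z ys) _)))
...   | _ | bumped row′ y′ len x<y′ nonzero count =
  bumped (y ∷ row′) y′ (cong suc len) x<y′ (≤-trans nonzero (m≤n+m _ _))
  (λ z → trans (+-assoc (indicator (z <ᵇ y)) (countGreater z row′) _)
    (trans (cong (indicator (z <ᵇ y) +_) (count z)) (sym (+-assoc (indicator (z <ᵇ y)) (countGreater z ys) _))))

rowInsert-size : ∀ x T → sum (map length (rowInsert x T)) ≡ suc (sum (map length T))
rowInsert-size x [] = refl
rowInsert-size x (row ∷ rows) with bump x row | bump-spec x row
... | _ | appended _ len _ = cong (_+ sum (map length rows)) len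
... | _ | bumped _ y len _ _ _ = trans (cong₂ _+_ len (rowInsert-size y rows)) (+-suc _ _)

rowInsert-countGreater : ∀ x T z →
  countGreater z (concat (rowInsert x T)) ≡ countGreater z (concat T) + indicator (z <ᵇ x)
rowInsert-countGreater x [] z = +-identityʳ _
rowInsert-countGreater x (row ∷ rows) z with bump x row | bump-spec x row
... | _ | appended row′ _ count = begin
  countGreater z (row′ ++ concat rows)
    ≡⟨ countGreater-++ z row′ _ ⟩
  countGreater z row′ + countGreater z (concat rows)
    ≡⟨ cong (_+ countGreater z (concat rows)) (count z) ⟩
  (countGreater z row + indicator (z <ᵇ x)) + countGreater z (concat rows)
    ≡⟨ xy∙z≈xz∙y (countGreater z row) _ _ ⟩
  (countGreater z row + countGreater z (concat rows)) + indicator (z <ᵇ x)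
    ≡⟨ cong (_+ indicator (z <ᵇ x)) (countGreater-++ z row _) ⟨
  countGreater z (row ++ concat rows) + indicator (z <ᵇ x) ∎
  where open ≡-Reasoning
... | _ | bumped row′ y _ _ _ count = begin
  countGreater z (row′ ++ concat (rowInsert y rows))
    ≡⟨ countGreater-++ z row′ _ ⟩
  countGreater z row′ + countGreater z (concat (rowInsert y rows))
    ≡⟨ cong (countGreater z row′ +_) (rowInsert-countGreater y rows z) ⟩
  countGreater z row′ + (countGreater z (concat rows) + indicator (z <ᵇ y))
    ≡⟨ cong (countGreater z row′ +_) (+-comm (countGreater z (concat rows)) _) ⟩
  countGreater z row′ + (indicator (z <ᵇ y) + countGreater z (concat rows))
    ≡⟨ +-assoc (countGreater z row′) _ _ ⟨
  (countGreater z row′ + indicator (z <ᵇ y)) + countGreater z (concat rows)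
    ≡⟨ cong (_+ countGreater z (concat rows)) (count z) ⟩
  (countGreater z row + indicator (z <ᵇ x)) + countGreater z (concat rows)
    ≡⟨ xy∙z≈xz∙y (countGreater z row) _ _ ⟩
  (countGreater z row + countGreater z (concat rows)) + indicator (z <ᵇ x)
    ≡⟨ cong (_+ indicator (z <ᵇ x)) (countGreater-++ z row _) ⟨
  countGreater z (row ++ concat rows) + indicator (z <ᵇ x) ∎
  where open ≡-Reasoning

rowInsert-nStat : ∀ x T → nStat (map length (rowInsert x T)) ≤ nStat (map length T) + countGreater x (concat T)
rowInsert-nStat x [] = z≤n
rowInsert-nStat x (row ∷ rows) with bump x row | bump-spec x row
... | _ | appended _ _ _ = m≤m+n _ _
... | _ | bumped _ y _ x<y nonzero _ = begin
  nStat (map length (rowInsert y rows)) + sum (map length (rowInsert y rows))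
    ≤⟨ +-mono-≤ (rowInsert-nStat y rows) (≤-reflexive (rowInsert-size y rows)) ⟩
  (N + countGreater y (concat rows)) + suc S
    ≡⟨ +-suc _ S ⟩
  suc ((N + countGreater y (concat rows)) + S)
    ≡⟨ cong suc (xy∙z≈xz∙y N _ S) ⟩
  suc ((N + S) + countGreater y (concat rows))
    ≡⟨ +-suc (N + S) _ ⟨
  (N + S) + suc (countGreater y (concat rows))
    ≤⟨ +-monoʳ-≤ (N + S) (+-mono-≤ nonzero (countGreater-antitone (concat rows) (<⇒≤ x<y))) ⟩
  (N + S) + (countGreater x row + countGreater x (concat rows))
    ≡⟨ cong ((N + S) +_) (countGreater-++ x row (concat rows)) ⟨
  (N + S) + countGreater x (row ++ concat rows) ∎
  where
    open ≤-Reasoning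
    N = nStat (map length rows)
    S = sum (map length rows)

nStat-insertion≤inv : ∀ σ T p → (∀ z → countGreater z (concat T) ≡ countGreater z p)
  → nStat (map length T) ≤ inv p
  → nStat (map length (foldl (λ T x → rowInsert x T) T σ)) ≤ inv (p ++ σ)
nStat-insertion≤inv [] T p _ bound = subst (nStat (map length T) ≤_) (cong inv (sym (++-identityʳ p))) bound
nStat-insertion≤inv (x ∷ σ) T p same bound =
  subst (λ q → _ ≤ inv q) (++-assoc p [ x ] σ)
    (nStat-insertion≤inv σ (rowInsert x T) (p ++ [ x ]) same′ bound′)
  where
    same′ : ∀ z → countGreater z (concat (rowInsert x T)) ≡ countGreater z (p ++ [ x ])
    same′ z = begin
      countGreater z (concat (rowInsert x T))  ≡⟨ rowInsert-countGreater x T z ⟩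
      countGreater z (concat T) + indicator (z <ᵇ x)  ≡⟨ cong₂ _+_ (same z) (sym (+-identityʳ _)) ⟩
      countGreater z p + countGreater z [ x ]  ≡⟨ countGreater-++ z p [ x ] ⟨
      countGreater z (p ++ [ x ]) ∎
      where open ≡-Reasoning
    bound′ : nStat (map length (rowInsert x T)) ≤ inv (p ++ [ x ])
    bound′ = begin
      nStat (map length (rowInsert x T))  ≤⟨ rowInsert-nStat x T ⟩
      nStat (map length T) + countGreater x (concat T)  ≤⟨ +-mono-≤ bound (≤-reflexive (same x)) ⟩
      inv p + countGreater x p  ≡⟨ inv-∷ʳ p x ⟨
      inv (p ++ [ x ]) ∎
      where open ≤-Reasoning

nStat-sh≤inv : ∀ σ → nStat (sh σ) ≤ inv σ
nStat-sh≤inv σ = nStat-insertion≤inv σ [] [] (λ _ → refl) z≤n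

-- Two-column shapes

triangle : ℕ → ℕ
triangle zero = 0
triangle (suc k) = k + triangle k

columns : ℕ → ℕ → List ℕ
columns zero b = replicate b 1
columns (suc a) zero = 1 ∷ columns a zero
columns (suc a) (suc b) = 2 ∷ columns a b

columns-zeroʳ : ∀ a → columns a zero ≡ replicate a 1
columns-zeroʳ zero = refl
columns-zeroʳ (suc a) = cong (1 ∷_) (columns-zeroʳ a)

columns-comm : ∀ a b → columns a b ≡ columns b a
columns-comm zero b = sym (columns-zeroʳ b)
columns-comm (suc a) zero = cong (1 ∷_) (columns-zeroʳ a)
columns-comm (suc a) (suc b) = cong (2 ∷_) (columns-comm a b)

columns-swap : ∀ {s r c1 c2} → (c1 ≡ s × c2 ≡ r) ⊎ (c1 ≡ r × c2 ≡ s) → columns c1 c2 ≡ columns s r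
columns-swap (inj₁ (refl , refl)) = refl
columns-swap {s} {r} (inj₂ (refl , refl)) = columns-comm r s

sum-columns : ∀ a b → sum (columns a b) ≡ a + b
sum-columns zero zero = refl
sum-columns zero (suc b) = cong suc (sum-columns zero b)
sum-columns (suc a) zero = cong suc (sum-columns a zero)
sum-columns (suc a) (suc b) = cong suc (trans (cong suc (sum-columns a b)) (sym (+-suc a b)))

nStat-columns : ∀ a b → nStat (columns a b) ≡ triangle a + triangle b
nStat-columns zero zero = refl
nStat-columns zero (suc b) =
  trans (cong₂ _+_ (nStat-columns zero b) (sum-columns zero b)) (+-comm (triangle b) b)
nStat-columns (suc a) zero = begin
  nStat (columns a zero) + sum (columns a zero)  ≡⟨ cong₂ _+_ (nStat-columns a zero) (sum-columns a zero) ⟩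
  (triangle a + 0) + (a + 0)                     ≡⟨ cong₂ _+_ (+-identityʳ _) (+-identityʳ a) ⟩
  triangle a + a                                 ≡⟨ +-comm (triangle a) a ⟩
  a + triangle a                                 ≡⟨ +-identityʳ _ ⟨
  (a + triangle a) + 0 ∎
  where open ≡-Reasoning
nStat-columns (suc a) (suc b) = begin
  nStat (columns a b) + sum (columns a b)         ≡⟨ cong₂ _+_ (nStat-columns a b) (sum-columns a b) ⟩
  (triangle a + triangle b) + (a + b)             ≡⟨ interchange (triangle a) _ _ _ ⟩
  (triangle a + a) + (triangle b + b)             ≡⟨ cong₂ _+_ (+-comm (triangle a) a) (+-comm (triangle b) b) ⟩
  (a + triangle a) + (b + triangle b) ∎
  where open ≡-Reasoning

countGe-none : ∀ {i} L → All (_< i) L → countGe i L ≡ 0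
countGe-none [] [] = refl
countGe-none (x ∷ L) (x<i ∷ below) rewrite <⇒<ᵇ≡true x<i = countGe-none L below

nonincreasing⇒≤head : ∀ {x xs} → Linked _≥_ (x ∷ xs) → All (_≤ x) (x ∷ xs)
nonincreasing⇒≤head = Linked⇒All (λ x≥y y≥z → ≤-trans y≥z x≥y) ≤-refl

partition≤2≡columns : ∀ L → Linked _≥_ L → All (1 ≤_) L → All (_≤ 2) L →
  L ≡ columns (countGe 1 L) (countGe 2 L)
partition≤2≡columns [] _ _ _ = refl
partition≤2≡columns (1 ∷ L) noninc (_ ∷ pos) (_ ∷ bounded)
  with countGe 2 L | countGe-none L (All.map s≤s (All.tail (nonincreasing⇒≤head noninc)))
     | partition≤2≡columns L (Linked.tail noninc) pos bounded
... | _ | refl | L≡columns = cong (1 ∷_) L≡columns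
partition≤2≡columns (2 ∷ L) noninc (_ ∷ pos) (_ ∷ bounded) =
  cong (2 ∷_) (partition≤2≡columns L (Linked.tail noninc) pos bounded)
partition≤2≡columns (suc (suc (suc _)) ∷ L) _ _ (s≤s (s≤s ()) ∷ _)

conj≡⇒columns : ∀ {s r} λ′ → IsPartition λ′ → conj λ′ ≡ s ∷ r ∷ [] → λ′ ≡ columns s r
conj≡⇒columns (2 ∷ L) (noninc , pos) refl = partition≤2≡columns (2 ∷ L) noninc pos (nonincreasing⇒≤head noninc)
conj≡⇒columns (1 ∷ L) _ ()
conj≡⇒columns (suc (suc (suc _)) ∷ L) _ ()

-- Intervals and decreasing runs

interval : ℕ → ℕ → List ℕ
interval b zero = []
interval b (suc k) = b ∷ interval (suc b) k

interval-increasing : ∀ b k → Linked _<_ (interval b k)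
interval-increasing b zero = []
interval-increasing b (suc zero) = [-]
interval-increasing b (suc (suc k)) = ≤-refl ∷ interval-increasing (suc b) (suc k)

interval-below : ∀ b k → All (_< b + k) (interval b k)
interval-below b zero = []
interval-below b (suc k) = subst (b <_) (sym (+-suc b k)) (s≤s (m≤m+n b k))
  ∷ subst (λ m → All (_< m) (interval (suc b) k)) (sym (+-suc b k)) (interval-below (suc b) k)

interval-≥ : ∀ b k → All (b ≤_) (interval b k)
interval-≥ b zero = []
interval-≥ b (suc k) = ≤-refl ∷ All.map (≤-trans (n≤1+n b)) (interval-≥ (suc b) k)

length-interval : ∀ b k → length (interval b k) ≡ k
length-interval b zero = refl
length-interval b (suc k) = cong suc (length-interval (suc b) k)

interval-∷ʳ : ∀ b k → interval b (suc k) ≡ interval b k ∷ʳ (b + k)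
interval-∷ʳ b zero = cong [_] (sym (+-identityʳ b))
interval-∷ʳ b (suc k) = cong (b ∷_) (trans (interval-∷ʳ (suc b) k) (cong (interval (suc b) k ∷ʳ_) (sym (+-suc b k))))

interval-++ : ∀ b k j → interval b k ++ interval (b + k) j ≡ interval b (k + j)
interval-++ b zero j = cong (λ c → interval c j) (+-identityʳ b)
interval-++ b (suc k) j = cong (b ∷_) (trans (cong (λ c → interval (suc b) k ++ interval c j) (+-suc b k)) (interval-++ (suc b) k j))

applyUpTo-interval : ∀ (f : ℕ → ℕ) b n → (∀ i → f i ≡ b + i) → applyUpTo f n ≡ interval b n
applyUpTo-interval f b zero _ = refl
applyUpTo-interval f b (suc n) f≗b+ = cong₂ _∷_ (trans (f≗b+ 0) (+-identityʳ b))
  (applyUpTo-interval (f ∘ suc) (suc b) n (λ i → trans (f≗b+ (suc i)) (+-suc b i)))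

map-suc-upTo : ∀ n → map suc (upTo n) ≡ interval 1 n
map-suc-upTo n = trans (map-upTo suc n) (applyUpTo-interval suc 1 n (λ _ → refl))

run-interval : ∀ c1 j m → run c1 j m ≡ interval (suc (c1 ∸ j)) m
run-interval c1 j m = trans (map-upTo _ m) (applyUpTo-interval _ (suc (c1 ∸ j)) m (+-suc (c1 ∸ j)))

desc-≤ : ∀ a k → All (_≤ a + k) (desc a k)
desc-≤ a zero = []
desc-≤ a (suc k) = ≤-refl ∷ All.map (λ x≤a+k → ≤-trans x≤a+k (+-monoʳ-≤ a (n≤1+n k))) (desc-≤ a k)

desc-> : ∀ a k → All (a <_) (desc a k)
desc-> a zero = []
desc-> a (suc k) = m<m+n a z<s ∷ desc-> a k

length-desc : ∀ a k → length (desc a k) ≡ k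
length-desc a zero = refl
length-desc a (suc k) = cong suc (length-desc a k)

desc-∷ʳ : ∀ a k → desc a (suc k) ≡ desc (suc a) k ∷ʳ suc a
desc-∷ʳ a zero = cong [_] (+-comm a 1)
desc-∷ʳ a (suc k) = cong₂ _∷_ (+-suc a (suc k)) (desc-∷ʳ a k)

desc-++ : ∀ a k xs → desc a (suc k) ++ xs ≡ desc (suc a) k ++ suc a ∷ xs
desc-++ a k xs = trans (cong (_++ xs) (desc-∷ʳ a k)) (++-assoc (desc (suc a) k) [ suc a ] xs)

desc-split : ∀ a j k → desc a (j + k) ≡ desc (a + j) k ++ desc a j
desc-split a j zero rewrite +-identityʳ j = refl
desc-split a j (suc k) = trans (cong (desc a) (+-suc j k))
  (cong₂ _∷_ (trans (+-suc a (j + k)) (trans (cong suc (sym (+-assoc a j k))) (sym (+-suc (a + j) k))))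
    (desc-split a j k))

desc↭interval : ∀ a k → desc a k ↭ interval (suc a) k
desc↭interval a zero = ↭-refl
desc↭interval a (suc k) = begin
  a + suc k ∷ desc a k               ↭⟨ prep _ (desc↭interval a k) ⟩
  a + suc k ∷ interval (suc a) k     ↭⟨ ∷↭∷ʳ _ _ ⟩
  interval (suc a) k ∷ʳ (a + suc k)  ≡⟨ cong (interval (suc a) k ∷ʳ_) (+-suc a k) ⟩
  interval (suc a) k ∷ʳ (suc a + k)  ≡⟨ interval-∷ʳ (suc a) k ⟨
  interval (suc a) (suc k) ∎
  where open PermutationReasoning

-- The minimal permutation

columnTableau : List ℕ → List ℕ → List (List ℕ)
columnTableau [] bs = map [_] bs
columnTableau (a ∷ as) [] = [ a ] ∷ columnTableau as []
columnTableau (a ∷ as) (b ∷ bs) = (a ∷ b ∷ []) ∷ columnTableau as bs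

columnTableau-[]ʳ : ∀ as → columnTableau [] as ≡ columnTableau as []
columnTableau-[]ʳ [] = refl
columnTableau-[]ʳ (a ∷ as) = cong ([ a ] ∷_) (columnTableau-[]ʳ as)

map-length-columnTableau : ∀ as bs → map length (columnTableau as bs) ≡ columns (length as) (length bs)
map-length-columnTableau [] [] = refl
map-length-columnTableau [] (b ∷ bs) = cong (1 ∷_) (map-length-columnTableau [] bs)
map-length-columnTableau (a ∷ as) [] = cong (1 ∷_) (map-length-columnTableau as [])
map-length-columnTableau (a ∷ as) (b ∷ bs) = cong (2 ∷_) (map-length-columnTableau as bs)

rowInsert-singletons : ∀ x bs → Linked _<_ (x ∷ bs) → rowInsert x (map [_] bs) ≡ map [_] (x ∷ bs)
rowInsert-singletons x [] _ = refl
rowInsert-singletons x (b ∷ bs) (x<b ∷ increasing) rewrite <⇒<ᵇ≡true x<b =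
  cong ([ x ] ∷_) (rowInsert-singletons b bs increasing)

rowInsert-columnTableau : ∀ x as bs → All (_< x) as → Linked _<_ (x ∷ bs) →
  rowInsert x (columnTableau as bs) ≡ columnTableau as (x ∷ bs)
rowInsert-columnTableau x [] bs _ increasing = rowInsert-singletons x bs increasing
rowInsert-columnTableau x (a ∷ as) [] (a<x ∷ _) _ rewrite ≥⇒<ᵇ≡false (<⇒≤ a<x) = refl
rowInsert-columnTableau x (a ∷ as) (b ∷ bs) (a<x ∷ below) (x<b ∷ increasing)
  rewrite ≥⇒<ᵇ≡false (<⇒≤ a<x) | <⇒<ᵇ≡true x<b =
  cong ((a ∷ x ∷ []) ∷_) (rowInsert-columnTableau b as bs (All.map (λ a<x → <-trans a<x x<b) below) increasing)

insert-desc-columnTableau : ∀ as c k j → All (_≤ c) as →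
  foldl (λ T x → rowInsert x T) (columnTableau as (interval (suc (c + k)) j)) (desc c k)
    ≡ columnTableau as (interval (suc c) (k + j))
insert-desc-columnTableau as c zero j _ rewrite +-identityʳ c = refl
insert-desc-columnTableau as c (suc k) j bounded
  rewrite rowInsert-columnTableau (c + suc k) as (interval (suc (c + suc k)) j)
            (All.map (λ a≤c → ≤-<-trans a≤c (m<m+n c z<s)) bounded)
            (interval-increasing (c + suc k) (suc j))
        | +-suc c k =
  trans (insert-desc-columnTableau as c k (suc j) bounded) (cong (columnTableau as ∘ interval (suc c)) (+-suc k j))

PTableau-minPerm : ∀ c1 c2 → PTableau (minPerm c1 c2) ≡ columnTableau (interval 1 c1) (interval (suc c1) c2)
PTableau-minPerm c1 c2 = begin
  foldl step [] (desc 0 c1 ++ desc c1 c2)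
    ≡⟨ foldl-++ step [] (desc 0 c1) (desc c1 c2) ⟩
  foldl step (foldl step (columnTableau [] []) (desc 0 c1)) (desc c1 c2)
    ≡⟨ cong (λ T → foldl step T (desc c1 c2)) (insert-desc-columnTableau [] 0 c1 0 []) ⟩
  foldl step (columnTableau [] (interval 1 (c1 + 0))) (desc c1 c2)
    ≡⟨ cong (λ T → foldl step T (desc c1 c2))
         (trans (cong (columnTableau [] ∘ interval 1) (+-identityʳ c1)) (columnTableau-[]ʳ (interval 1 c1))) ⟩
  foldl step (columnTableau (interval 1 c1) (interval (suc (c1 + c2)) 0)) (desc c1 c2)
    ≡⟨ insert-desc-columnTableau (interval 1 c1) c1 c2 0 (All.map ≤-pred (interval-below 1 c1)) ⟩
  columnTableau (interval 1 c1) (interval (suc c1) (c2 + 0))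
    ≡⟨ cong (columnTableau (interval 1 c1) ∘ interval (suc c1)) (+-identityʳ c2) ⟩
  columnTableau (interval 1 c1) (interval (suc c1) c2) ∎
  where
    open ≡-Reasoning
    step : List (List ℕ) → ℕ → List (List ℕ)
    step T x = rowInsert x T

sh-minPerm : ∀ c1 c2 → sh (minPerm c1 c2) ≡ columns c1 c2
sh-minPerm c1 c2 rewrite PTableau-minPerm c1 c2
  | map-length-columnTableau (interval 1 c1) (interval (suc c1) c2)
  | length-interval 1 c1 | length-interval (suc c1) c2 = refl

inv-desc : ∀ a k → inv (desc a k) ≡ triangle k
inv-desc a zero = refl
inv-desc a (suc k) = cong₂ _+_
  (trans (countLess-all (a + suc k) (desc a k)
           (All.map (λ x≤a+k → ≤-<-trans x≤a+k (+-monoʳ-< a (n<1+n k))) (desc-≤ a k)))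
         (length-desc a k))
  (inv-desc a k)

inv-minPerm : ∀ c1 c2 → inv (minPerm c1 c2) ≡ nStat (sh (minPerm c1 c2))
inv-minPerm c1 c2 = begin
  inv (desc 0 c1 ++ desc c1 c2)
    ≡⟨ inv-++-increasing (desc 0 c1) (desc c1 c2)
         (All.map (λ x≤c1 → All.map (≤-<-trans x≤c1) (desc-> c1 c2)) (desc-≤ 0 c1)) ⟩
  inv (desc 0 c1) + inv (desc c1 c2)
    ≡⟨ cong₂ _+_ (inv-desc 0 c1) (inv-desc c1 c2) ⟩
  triangle c1 + triangle c2
    ≡⟨ nStat-columns c1 c2 ⟨
  nStat (columns c1 c2)
    ≡⟨ cong nStat (sh-minPerm c1 c2) ⟨
  nStat (sh (minPerm c1 c2)) ∎
  where open ≡-Reasoning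

minPerm-isPerm : ∀ c1 c2 → IsPerm (c1 + c2) (minPerm c1 c2)
minPerm-isPerm c1 c2 = ↭-trans (++⁺ (desc↭interval 0 c1) (desc↭interval c1 c2))
  (↭-reflexive (trans (interval-++ 1 c1 c2) (sym (map-suc-upTo (c1 + c2)))))

minPerm-isMinInv : ∀ c1 c2 → IsMinInv (c1 + c2) (sh (minPerm c1 c2)) (inv (minPerm c1 c2))
minPerm-isMinInv c1 c2 = (minPerm c1 c2 , minPerm-isPerm c1 c2 , refl , refl) , minimal
  where
    minimal : ∀ σ → IsPerm (c1 + c2) σ → sh σ ≡ sh (minPerm c1 c2) → inv (minPerm c1 c2) ≤ inv σ
    minimal σ _ same-shape = begin
      inv (minPerm c1 c2)          ≡⟨ inv-minPerm c1 c2 ⟩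
      nStat (sh (minPerm c1 c2))   ≡⟨ cong nStat same-shape ⟨
      nStat (sh σ)                 ≤⟨ nStat-sh≤inv σ ⟩
      inv σ ∎
      where open ≤-Reasoning

-- Transposing adjacent values

isPerm⇒unique : ∀ {n σ} → IsPerm n σ → Unique σ
isPerm⇒unique {n} σ↭ = Unique-resp-↭ (↭⇒↭ₛ (↭-sym σ↭)) (UniqueP.map⁺ suc-injective (UniqueP.upTo⁺ n))

isPerm⇒∈ : ∀ {n σ x} → IsPerm n σ → x < n → suc x ∈ σ
isPerm⇒∈ σ↭ x<n = ∈-resp-↭ (↭-sym σ↭) (∈-map⁺ suc (∈-upTo⁺ x<n))

transpose : ℕ → ℕ → ℕ
transpose t x = if x ≡ᵇ t then suc t else (if x ≡ᵇ suc t then t else x)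

≡ᵇ-refl : ∀ x → (x ≡ᵇ x) ≡ true
≡ᵇ-refl zero = refl
≡ᵇ-refl (suc x) = ≡ᵇ-refl x

≢⇒≡ᵇ≡false : ∀ {x y} → x ≢ y → (x ≡ᵇ y) ≡ false
≢⇒≡ᵇ≡false {x} {y} x≢y with x ≡ᵇ y in eq
... | false = refl
... | true = contradiction (≡ᵇ⇒≡ x y (subst T (sym eq) _)) x≢y

transpose-t : ∀ t → transpose t t ≡ suc t
transpose-t t rewrite ≡ᵇ-refl t = refl

transpose-suc : ∀ t → transpose t (suc t) ≡ t
transpose-suc t rewrite ≢⇒≡ᵇ≡false (1+n≢n {t}) | ≡ᵇ-refl t = refl

transpose-other : ∀ {t x} → x ≢ t → x ≢ suc t → transpose t x ≡ x
transpose-other x≢t x≢t+1 rewrite ≢⇒≡ᵇ≡false x≢t | ≢⇒≡ᵇ≡false x≢t+1 = refl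

map-transpose-interval : ∀ t b k → b ≤ t → suc t < b + k → map (transpose t) (interval b k) ↭ interval b k
map-transpose-interval t b zero b≤t t<b = contradiction b≤t (<⇒≱ (<⇒≤ (subst (suc t <_) (+-identityʳ b) t<b)))
map-transpose-interval t b (suc k) b≤t t<b+k with b ≟ t
... | no b≢t rewrite transpose-other b≢t (<⇒≢ (s≤s b≤t)) =
  prep b (map-transpose-interval t (suc b) k (≤∧≢⇒< b≤t b≢t) (subst (suc t <_) (+-suc b k) t<b+k))
... | yes refl with k
...   | zero = contradiction (subst (suc b <_) (+-comm b 1) t<b+k) (n≮n (suc b))
...   | suc k
  rewrite transpose-t b | transpose-suc b
        | map-id-local (All.map (λ b+2≤x → transpose-other (<⇒≢ (≤-trans (n≤1+n _) b+2≤x) ∘ sym) (<⇒≢ b+2≤x ∘ sym))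
                          (interval-≥ (suc (suc b)) k)) = swap (suc b) b ↭-refl

swapVal-isPerm : ∀ {n σ} t → 1 ≤ t → suc t ≤ n → IsPerm n σ → IsPerm n (swapVal t σ)
swapVal-isPerm {n} t 1≤t t<n σ↭ = ↭-trans (Perm.map⁺ (transpose t) σ↭)
  (subst (λ ids → map (transpose t) ids ↭ ids) (sym (map-suc-upTo n)) (map-transpose-interval t 1 n 1≤t (s≤s t<n)))

<ᵇ-suc : ∀ {x y} → x ≢ y → (x <ᵇ suc y) ≡ (x <ᵇ y)
<ᵇ-suc {zero} {zero} x≢y = contradiction refl x≢y
<ᵇ-suc {zero} {suc y} _ = refl
<ᵇ-suc {suc x} {zero} _ = refl
<ᵇ-suc {suc x} {suc y} x≢y = <ᵇ-suc (x≢y ∘ cong suc)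

suc-<ᵇ : ∀ {x y} → y ≢ suc x → (suc x <ᵇ y) ≡ (x <ᵇ y)
suc-<ᵇ {x} {zero} _ = refl
suc-<ᵇ {x} {suc y} y≢x+1 = sym (<ᵇ-suc (y≢x+1 ∘ cong suc ∘ sym))

-- No number lies strictly between t and t + 1, so transposing them changes only their own comparison.
transpose-<ᵇ : ∀ t x y → (x ≡ t → y ≢ suc t) → (x ≡ suc t → y ≢ t) →
  (transpose t y <ᵇ transpose t x) ≡ (y <ᵇ x)
transpose-<ᵇ t x y x≡t⇒y≢t+1 x≡t+1⇒y≢t with x ≟ t | x ≟ suc t
... | yes refl | _ with y ≟ x
...   | yes refl rewrite transpose-t x = refl
...   | no y≢t rewrite transpose-t x | transpose-other y≢t (x≡t⇒y≢t+1 refl) = <ᵇ-suc y≢t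
transpose-<ᵇ t x y _ x≡t+1⇒y≢t | no _ | yes refl with y ≟ suc t
...   | yes refl rewrite transpose-suc t = refl
...   | no y≢t+1 rewrite transpose-suc t | transpose-other (x≡t+1⇒y≢t refl) y≢t+1 = sym (<ᵇ-suc (x≡t+1⇒y≢t refl))
transpose-<ᵇ t x y _ _ | no x≢t | no x≢t+1 rewrite transpose-other x≢t x≢t+1 with y ≟ t | y ≟ suc t
... | yes refl | _ rewrite transpose-t y = suc-<ᵇ x≢t+1
... | no _ | yes refl rewrite transpose-suc t = sym (suc-<ᵇ x≢t+1)
... | no y≢t | no y≢t+1 rewrite transpose-other y≢t y≢t+1 = refl

countLess-transpose : ∀ t x L → All (λ y → (transpose t y <ᵇ transpose t x) ≡ (y <ᵇ x)) L →
  countLess (transpose t x) (map (transpose t) L) ≡ countLess x L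
countLess-transpose t x [] [] = refl
countLess-transpose t x (y ∷ L) (same ∷ sames) = cong₂ _+_ (cong indicator same) (countLess-transpose t x L sames)

inv-transpose-∉ : ∀ t L → All (t ≢_) L → inv (map (transpose t) L) ≡ inv L
inv-transpose-∉ t [] [] = refl
inv-transpose-∉ t (x ∷ L) (t≢x ∷ t∉L) = cong₂ _+_
  (countLess-transpose t x L
    (All.map (λ t≢y → transpose-<ᵇ t x _ (λ x≡t → contradiction (sym x≡t) t≢x) (λ _ y≡t → t≢y (sym y≡t))) t∉L))
  (inv-transpose-∉ t L t∉L)

countLess-suc-∉ : ∀ t L → All (t ≢_) L → countLess (suc t) L ≡ countLess t L
countLess-suc-∉ t [] [] = refl
countLess-suc-∉ t (y ∷ L) (t≢y ∷ t∉L) = cong₂ _+_ (cong indicator (<ᵇ-suc (t≢y ∘ sym))) (countLess-suc-∉ t L t∉L)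

countLess-transpose-suc : ∀ t L → All (t ≢_) L → Unique L → suc t ∈ L →
  countLess (suc t) (map (transpose t) L) ≡ suc (countLess t L)
countLess-transpose-suc t (y ∷ L) (_ ∷ t∉L) (y∉L ∷ _) (here refl)
  rewrite transpose-suc t | <⇒<ᵇ≡true (n<1+n t) | ≥⇒<ᵇ≡false (n≤1+n t)
        | map-id-local (All.zipWith (λ (t≢x , t+1≢x) → transpose-other (t≢x ∘ sym) (t+1≢x ∘ sym)) (t∉L , y∉L)) =
  cong suc (countLess-suc-∉ t L t∉L)
countLess-transpose-suc t (y ∷ L) (t≢y ∷ t∉L) (y∉L ∷ unique) (there t+1∈L)
  rewrite transpose-other (t≢y ∘ sym) (All.lookup y∉L t+1∈L) | <ᵇ-suc (t≢y ∘ sym) =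
  trans (cong (indicator (y <ᵇ t) +_) (countLess-transpose-suc t L t∉L unique t+1∈L)) (+-suc _ _)

inv-swapVal : ∀ t A B → Unique (A ++ B) → t ∈ A → suc t ∈ B → inv (swapVal t (A ++ B)) ≡ suc (inv (A ++ B))
inv-swapVal t (x ∷ A) B (x∉ ∷ unique) (here refl) t+1∈B
  rewrite transpose-t x | countLess-transpose-suc x (A ++ B) x∉ unique (∈-++⁺ʳ A t+1∈B)
        | inv-transpose-∉ x (A ++ B) x∉ = refl
inv-swapVal t (x ∷ A) B (x∉ ∷ unique) (there t∈A) t+1∈B = trans
  (cong₂ _+_
    (countLess-transpose t x (A ++ B) (All.universal (λ y → transpose-<ᵇ t x y
      (λ x≡t → contradiction x≡t (All.lookup x∉ (∈-++⁺ˡ t∈A)))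
      (λ x≡t+1 → contradiction x≡t+1 (All.lookup x∉ (∈-++⁺ʳ A t+1∈B)))) (A ++ B)))
    (inv-swapVal t A B unique t∈A t+1∈B))
  (+-suc _ _)

-- Swapping adjacent positions

swapPos-↭ : ∀ t σ → swapPos t σ ↭ σ
swapPos-↭ zero σ = ↭-refl
swapPos-↭ (suc zero) [] = ↭-refl
swapPos-↭ (suc zero) (a ∷ []) = ↭-refl
swapPos-↭ (suc zero) (a ∷ b ∷ σ) = swap b a ↭-refl
swapPos-↭ (suc (suc t)) [] = ↭-refl
swapPos-↭ (suc (suc t)) (a ∷ σ) = prep a (swapPos-↭ (suc t) σ)

applyAll-swapPos-↭ : ∀ ts σ → applyAll swapPos ts σ ↭ σ
applyAll-swapPos-↭ [] σ = ↭-refl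
applyAll-swapPos-↭ (t ∷ ts) σ = ↭-trans (applyAll-swapPos-↭ ts (swapPos t σ)) (swapPos-↭ t σ)

applyAll-++ : ∀ f ts us σ → applyAll f (ts ++ us) σ ≡ applyAll f us (applyAll f ts σ)
applyAll-++ f [] us σ = refl
applyAll-++ f (t ∷ ts) us σ = applyAll-++ f ts us (f t σ)

swapPos-at : ∀ Q a b R → swapPos (suc (length Q)) (Q ++ a ∷ b ∷ R) ≡ Q ++ b ∷ a ∷ R
swapPos-at [] a b R = refl
swapPos-at (x ∷ []) a b R = refl
swapPos-at (x ∷ y ∷ Q) a b R = cong (x ∷_) (swapPos-at (y ∷ Q) a b R)

countLess-swap : ∀ x Q a b R → countLess x (Q ++ a ∷ b ∷ R) ≡ countLess x (Q ++ b ∷ a ∷ R)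
countLess-swap x [] a b R = x∙yz≈y∙xz (indicator (a <ᵇ x)) (indicator (b <ᵇ x)) (countLess x R)
countLess-swap x (y ∷ Q) a b R = cong (indicator (y <ᵇ x) +_) (countLess-swap x Q a b R)

inv-swap : ∀ Q a b R → a < b → inv (Q ++ b ∷ a ∷ R) ≡ suc (inv (Q ++ a ∷ b ∷ R))
inv-swap [] a b R a<b rewrite <⇒<ᵇ≡true a<b | ≥⇒<ᵇ≡false (<⇒≤ a<b) =
  cong suc (x∙yz≈y∙xz (countLess b R) (countLess a R) (inv R))
inv-swap (x ∷ Q) a b R a<b =
  trans (cong₂ _+_ (countLess-swap x Q b a R) (inv-swap Q a b R a<b)) (+-suc _ _)

length-∷ʳ : ∀ (Q : List ℕ) x → length (Q ∷ʳ x) ≡ suc (length Q)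
length-∷ʳ Q x = trans (length-++ Q) (+-comm (length Q) 1)

swapPos-moveRight : ∀ Q v B R →
  applyAll swapPos (interval (suc (length Q)) (length B)) (Q ++ v ∷ B ++ R) ≡ Q ++ B ++ v ∷ R
swapPos-moveRight Q v [] R = refl
swapPos-moveRight Q v (b ∷ B) R = begin
  applyAll swapPos (interval (suc (suc (length Q))) (length B)) (swapPos (suc (length Q)) (Q ++ v ∷ b ∷ B ++ R))
    ≡⟨ cong (applyAll swapPos (interval (suc (suc (length Q))) (length B))) (swapPos-at Q v b (B ++ R)) ⟩
  applyAll swapPos (interval (suc (suc (length Q))) (length B)) (Q ++ b ∷ v ∷ B ++ R)
    ≡⟨ cong₂ (λ l σ → applyAll swapPos (interval (suc l) (length B)) σ) (length-∷ʳ Q b) (++-assoc Q [ b ] _) ⟨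
  applyAll swapPos (interval (suc (length (Q ∷ʳ b))) (length B)) ((Q ∷ʳ b) ++ v ∷ B ++ R)
    ≡⟨ swapPos-moveRight (Q ∷ʳ b) v B R ⟩
  (Q ∷ʳ b) ++ B ++ v ∷ R
    ≡⟨ ++-assoc Q [ b ] _ ⟩
  Q ++ b ∷ B ++ v ∷ R ∎
  where open ≡-Reasoning

inv-moveRight : ∀ Q v B R → All (v <_) B → inv (Q ++ B ++ v ∷ R) ≡ inv (Q ++ v ∷ B ++ R) + length B
inv-moveRight Q v [] R [] = sym (+-identityʳ _)
inv-moveRight Q v (b ∷ B) R (v<b ∷ v<B) = begin
  inv (Q ++ b ∷ B ++ v ∷ R)          ≡⟨ cong inv (++-assoc Q [ b ] _) ⟨
  inv ((Q ∷ʳ b) ++ B ++ v ∷ R)       ≡⟨ inv-moveRight (Q ∷ʳ b) v B R v<B ⟩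
  inv ((Q ∷ʳ b) ++ v ∷ B ++ R) + length B
    ≡⟨ cong (λ σ → inv σ + length B) (++-assoc Q [ b ] _) ⟩
  inv (Q ++ b ∷ v ∷ B ++ R) + length B
    ≡⟨ cong (_+ length B) (inv-swap Q v b (B ++ R) v<b) ⟩
  suc (inv (Q ++ v ∷ b ∷ B ++ R)) + length B
    ≡⟨ +-suc _ (length B) ⟨
  inv (Q ++ v ∷ b ∷ B ++ R) + suc (length B) ∎
  where open ≡-Reasoning

-- The jump actions on the minimal permutation

+≡⇒∸≡ : ∀ {m n o} → m + n ≡ o → o ∸ n ≡ m
+≡⇒∸≡ {m} {n} refl = m+n∸n≡m m n

swapPos-row : ∀ a K B R → All (suc a <_) B →
  (applyAll swapPos (interval (suc K) (length B)) (desc a (suc K) ++ B ++ R) ≡ desc (suc a) K ++ B ++ suc a ∷ R)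
  × (inv (desc (suc a) K ++ B ++ suc a ∷ R) ≡ inv (desc a (suc K) ++ B ++ R) + length B)
swapPos-row a K B R a<B =
  trans (cong₂ (λ l σ → applyAll swapPos (interval (suc l) (length B)) σ)
               (sym (length-desc (suc a) K)) (desc-++ a K (B ++ R)))
        (swapPos-moveRight (desc (suc a) K) (suc a) B R)
  , trans (inv-moveRight (desc (suc a) K) (suc a) B R a<B)
          (cong (λ σ → inv σ + length B) (sym (desc-++ a K (B ++ R))))

length-take-≤ : ∀ {m} (xs : List ℕ) → m ≤ length xs → length (take m xs) ≡ m
length-take-≤ {m} xs m≤|xs| = trans (length-take m xs) (m≤n⇒m⊓n≡m m≤|xs|)

swapPos-run : ∀ c1 a K m B R → suc a + K ≡ c1 → m ≤ length B → All (c1 <_) B →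
  (applyAll swapPos (run c1 (suc a) m) (desc a (suc K) ++ B ++ R) ≡ desc (suc a) K ++ take m B ++ suc a ∷ drop m B ++ R)
  × (inv (desc (suc a) K ++ take m B ++ suc a ∷ drop m B ++ R) ≡ inv (desc a (suc K) ++ B ++ R) + m)
swapPos-run c1 a K m B R a+1+K≡c1 m≤|B| c1<B =
  trans (cong₂ (applyAll swapPos) run≡ split) (proj₁ row)
  , trans (proj₂ row) (cong₂ (λ σ l → inv σ + l) (sym split) (length-take-≤ B m≤|B|))
  where
    split : desc a (suc K) ++ B ++ R ≡ desc a (suc K) ++ take m B ++ drop m B ++ R
    split = cong (desc a (suc K) ++_) (trans (cong (_++ R) (sym (take++drop≡id m B))) (++-assoc (take m B) _ R))
    run≡ : run c1 (suc a) m ≡ interval (suc K) (length (take m B))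
    run≡ = trans (run-interval c1 (suc a) m)
      (cong₂ (λ q l → interval (suc q) l) (+≡⇒∸≡ (trans (+-comm K (suc a)) a+1+K≡c1)) (sym (length-take-≤ B m≤|B|)))
    a<B : All (suc a <_) (take m B)
    a<B = All.map (≤-<-trans (≤-trans (m≤m+n (suc a) K) (≤-reflexive a+1+K≡c1))) (AllP.take⁺ m c1<B)
    row = swapPos-row a K (take m B) (drop m B ++ R) a<B

innerAct-desc : ∀ c1 μ a k B R → a + (length μ + k) ≡ c1 → Linked _≥_ (length B ∷ μ) → All (c1 <_) B →
  Σ (List ℕ) λ W →
    (applyAll swapPos (jumpWord c1 (suc a) μ) (desc a (length μ + k) ++ B ++ R) ≡ desc (a + length μ) k ++ W)
    × (inv (desc (a + length μ) k ++ W) ≡ inv (desc a (length μ + k) ++ B ++ R) + sum μ)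
innerAct-desc c1 [] a k B R _ _ _ rewrite +-identityʳ a = B ++ R , refl , sym (+-identityʳ _)
innerAct-desc c1 (m ∷ μ) a k B R a+K≡c1 (m≤|B| ∷ μ-nonincreasing) c1<B = W , word-eq , inv-eq
  where
    K = length μ + k
    σ = desc a (suc K) ++ B ++ R
    rest = jumpWord c1 (suc (suc a)) μ
    a+1+K≡c1 : suc a + K ≡ c1
    a+1+K≡c1 = trans (sym (+-suc a K)) a+K≡c1
    row = swapPos-run c1 a K m B R a+1+K≡c1 m≤|B| c1<B
    ih = innerAct-desc c1 μ (suc a) k (take m B) (suc a ∷ drop m B ++ R) a+1+K≡c1
           (subst (λ l → Linked _≥_ (l ∷ μ)) (sym (length-take-≤ B m≤|B|)) μ-nonincreasing) (AllP.take⁺ m c1<B)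
    W = proj₁ ih
    shift : desc (suc a + length μ) k ++ W ≡ desc (a + suc (length μ)) k ++ W
    shift = cong (λ b → desc b k ++ W) (sym (+-suc a (length μ)))
    word-eq : applyAll swapPos (run c1 (suc a) m ++ rest) σ ≡ desc (a + suc (length μ)) k ++ W
    word-eq = begin
      applyAll swapPos (run c1 (suc a) m ++ rest) σ                      ≡⟨ applyAll-++ swapPos (run c1 (suc a) m) rest σ ⟩
      applyAll swapPos rest (applyAll swapPos (run c1 (suc a) m) σ)      ≡⟨ cong (applyAll swapPos rest) (proj₁ row) ⟩
      applyAll swapPos rest (desc (suc a) K ++ take m B ++ suc a ∷ drop m B ++ R) ≡⟨ proj₁ (proj₂ ih) ⟩
      desc (suc a + length μ) k ++ W                                    ≡⟨ shift ⟩
      desc (a + suc (length μ)) k ++ W ∎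
      where open ≡-Reasoning
    inv-eq : inv (desc (a + suc (length μ)) k ++ W) ≡ inv σ + (m + sum μ)
    inv-eq = begin
      inv (desc (a + suc (length μ)) k ++ W)                            ≡⟨ cong inv shift ⟨
      inv (desc (suc a + length μ) k ++ W)                              ≡⟨ proj₂ (proj₂ ih) ⟩
      inv (desc (suc a) K ++ take m B ++ suc a ∷ drop m B ++ R) + sum μ  ≡⟨ cong (_+ sum μ) (proj₂ row) ⟩
      (inv σ + m) + sum μ                                               ≡⟨ +-assoc (inv σ) m (sum μ) ⟩
      inv σ + (m + sum μ) ∎
      where open ≡-Reasoning

swapVal-step : ∀ {n} p X D R → IsPerm n (X ++ suc p ∷ D ++ R) →
  All (suc (suc p) <_) X → All (_< suc p) D → suc (suc p) ≤ n →
  (swapVal (suc p) (X ++ suc p ∷ D ++ R) ≡ X ++ suc (suc p) ∷ D ++ map (transpose (suc p)) R)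
  × (inv (X ++ suc (suc p) ∷ D ++ map (transpose (suc p)) R) ≡ suc (inv (X ++ suc p ∷ D ++ R)))
swapVal-step p X D R σ-perm p+1<X D<p+1 p+1<n = swapped , inv-eq
  where
    f = transpose (suc p)
    p+1∉X : map f X ≡ X
    p+1∉X = map-id-local (All.map (λ p+1<x → transpose-other (<⇒≢ (<-trans (n<1+n _) p+1<x) ∘ sym) (<⇒≢ p+1<x ∘ sym)) p+1<X)
    p+1∉D : map f D ≡ D
    p+1∉D = map-id-local (All.map (λ x<p+1 → transpose-other (<⇒≢ x<p+1) (<⇒≢ (<-trans x<p+1 (n<1+n _)))) D<p+1)
    swapped : map f (X ++ suc p ∷ D ++ R) ≡ X ++ suc (suc p) ∷ D ++ map f R
    swapped = begin
      map f (X ++ suc p ∷ D ++ R)              ≡⟨ map-++ f X _ ⟩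
      map f X ++ f (suc p) ∷ map f (D ++ R)    ≡⟨ cong₂ (λ Y Z → Y ++ f (suc p) ∷ Z) p+1∉X (map-++ f D R) ⟩
      X ++ f (suc p) ∷ map f D ++ map f R      ≡⟨ cong₂ (λ v Z → X ++ v ∷ Z ++ map f R) (transpose-t (suc p)) p+1∉D ⟩
      X ++ suc (suc p) ∷ D ++ map f R ∎
      where open ≡-Reasoning
    reassoc : X ++ suc p ∷ D ++ R ≡ (X ++ suc p ∷ D) ++ R
    reassoc = sym (++-assoc X (suc p ∷ D) R)
    p+2∈R : suc (suc p) ∈ R
    p+2∈R with ∈-++⁻ X (isPerm⇒∈ σ-perm p+1<n)
    ... | inj₁ ∈X = contradiction refl (<⇒≢ (All.lookup p+1<X ∈X))
    ... | inj₂ (here p+2≡p+1) = contradiction p+2≡p+1 1+n≢n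
    ... | inj₂ (there ∈D++R) with ∈-++⁻ D ∈D++R
    ...   | inj₁ ∈D = contradiction (All.lookup D<p+1 ∈D) (n≮n (suc p) ∘ <-trans (n<1+n _))
    ...   | inj₂ ∈R = ∈R
    inv-eq : inv (X ++ suc (suc p) ∷ D ++ map f R) ≡ suc (inv (X ++ suc p ∷ D ++ R))
    inv-eq = begin
      inv (X ++ suc (suc p) ∷ D ++ map f R)    ≡⟨ cong inv swapped ⟨
      inv (map f (X ++ suc p ∷ D ++ R))        ≡⟨ cong (inv ∘ map f) reassoc ⟩
      inv (map f ((X ++ suc p ∷ D) ++ R))
        ≡⟨ inv-swapVal (suc p) (X ++ suc p ∷ D) R (subst Unique reassoc (isPerm⇒unique σ-perm)) (∈-++⁺ʳ X (here refl)) p+2∈R ⟩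
      suc (inv ((X ++ suc p ∷ D) ++ R))        ≡⟨ cong (suc ∘ inv) reassoc ⟨
      suc (inv (X ++ suc p ∷ D ++ R)) ∎
      where open ≡-Reasoning

swapVal-moveUp : ∀ {n} m p X D R → IsPerm n (X ++ suc p ∷ D ++ R) →
  All (suc p + m <_) X → All (_< suc p) D → suc p + m ≤ n →
  Σ (List ℕ) λ R′ →
    (applyAll swapVal (interval (suc p) m) (X ++ suc p ∷ D ++ R) ≡ X ++ (suc p + m) ∷ D ++ R′)
    × (inv (X ++ (suc p + m) ∷ D ++ R′) ≡ inv (X ++ suc p ∷ D ++ R) + m)
    × IsPerm n (X ++ (suc p + m) ∷ D ++ R′)
swapVal-moveUp zero p X D R σ-perm _ _ _ rewrite +-identityʳ p = R , refl , sym (+-identityʳ _) , σ-perm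
swapVal-moveUp {n} (suc m) p X D R σ-perm top<X D<p+1 top≤n =
  R′ , moved , inv-eq , subst (λ v → IsPerm n (X ++ v ∷ D ++ R′)) top-eq (proj₂ (proj₂ (proj₂ ih)))
  where
    top-eq : suc (suc p) + m ≡ suc p + suc m
    top-eq = cong suc (sym (+-suc p m))
    p+2≤top : suc (suc p) ≤ suc p + suc m
    p+2≤top = ≤-trans (s≤s (s≤s (m≤m+n p m))) (≤-reflexive top-eq)
    step = swapVal-step p X D R σ-perm (All.map (≤-<-trans p+2≤top) top<X) D<p+1 (≤-trans p+2≤top top≤n)
    ih = swapVal-moveUp m (suc p) X D (map (transpose (suc p)) R)
           (subst (IsPerm n) (proj₁ step) (swapVal-isPerm (suc p) (s≤s z≤n) (≤-trans p+2≤top top≤n) σ-perm))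
           (subst (λ v → All (v <_) X) (sym top-eq) top<X) (All.map (λ x<p+1 → <-trans x<p+1 (n<1+n _)) D<p+1)
           (subst (_≤ n) (sym top-eq) top≤n)
    R′ = proj₁ ih
    moved : applyAll swapVal (interval (suc (suc p)) m) (swapVal (suc p) (X ++ suc p ∷ D ++ R)) ≡ X ++ (suc p + suc m) ∷ D ++ R′
    moved = trans (cong (applyAll swapVal (interval (suc (suc p)) m)) (proj₁ step))
                  (trans (proj₁ (proj₂ ih)) (cong (λ v → X ++ v ∷ D ++ R′) top-eq))
    inv-eq : inv (X ++ (suc p + suc m) ∷ D ++ R′) ≡ inv (X ++ suc p ∷ D ++ R) + suc m
    inv-eq = begin
      inv (X ++ (suc p + suc m) ∷ D ++ R′)                              ≡⟨ cong (λ v → inv (X ++ v ∷ D ++ R′)) top-eq ⟨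
      inv (X ++ (suc (suc p) + m) ∷ D ++ R′)                            ≡⟨ proj₁ (proj₂ (proj₂ ih)) ⟩
      inv (X ++ suc (suc p) ∷ D ++ map (transpose (suc p)) R) + m       ≡⟨ cong (_+ m) (proj₂ step) ⟩
      suc (inv (X ++ suc p ∷ D ++ R)) + m                               ≡⟨ +-suc _ m ⟨
      inv (X ++ suc p ∷ D ++ R) + suc m ∎
      where open ≡-Reasoning

swapVal-run : ∀ {n} c1 i b k m X R → b + k + suc i ≡ c1 → All (suc (b + k) + m <_) X → suc (b + k) + m ≤ n →
  IsPerm n (X ++ desc b (suc k) ++ R) →
  Σ (List ℕ) λ R′ →
    (applyAll swapVal (run c1 (suc i) m) (X ++ desc b (suc k) ++ R) ≡ (X ∷ʳ (suc (b + k) + m)) ++ desc b k ++ R′)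
    × (inv ((X ∷ʳ (suc (b + k) + m)) ++ desc b k ++ R′) ≡ inv (X ++ desc b (suc k) ++ R) + m)
    × IsPerm n ((X ∷ʳ (suc (b + k) + m)) ++ desc b k ++ R′)
swapVal-run {n} c1 i b k m X R p+i+1≡c1 top<X top≤n σ-perm =
  R′ , trans (cong₂ (applyAll swapVal) run≡ σ≡) (trans (proj₁ (proj₂ move)) reassoc)
     , trans (cong inv (sym reassoc)) (trans (proj₁ (proj₂ (proj₂ move))) (cong (λ τ → inv τ + m) (sym σ≡)))
     , subst (IsPerm n) reassoc (proj₂ (proj₂ (proj₂ move)))
  where
    p = b + k
    σ≡ : X ++ desc b (suc k) ++ R ≡ X ++ suc p ∷ desc b k ++ R
    σ≡ = cong (λ v → X ++ v ∷ desc b k ++ R) (+-suc b k)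
    run≡ : run c1 (suc i) m ≡ interval (suc p) m
    run≡ = trans (run-interval c1 (suc i) m) (cong (λ q → interval (suc q) m) (+≡⇒∸≡ p+i+1≡c1))
    move = swapVal-moveUp m p X (desc b k) R (subst (IsPerm n) σ≡ σ-perm) top<X (All.map s≤s (desc-≤ b k)) top≤n
    R′ = proj₁ move
    reassoc : X ++ (suc p + m) ∷ desc b k ++ R′ ≡ (X ∷ʳ (suc p + m)) ++ desc b k ++ R′
    reassoc = sym (++-assoc X [ suc p + m ] _)

outerAct-desc : ∀ {n} c1 ν i b k X R M → b + k + i ≡ c1 → Linked _≥_ (M ∷ ν) → length ν ≤ k →
  All (b + k + M <_) X → b + k + M ≤ n → IsPerm n (X ++ desc b k ++ R) →
  (inv (applyAll swapVal (jumpWord c1 (suc i) ν) (X ++ desc b k ++ R)) ≡ inv (X ++ desc b k ++ R) + sum ν)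
  × IsPerm n (applyAll swapVal (jumpWord c1 (suc i) ν) (X ++ desc b k ++ R))
outerAct-desc c1 [] i b k X R M _ _ _ _ _ σ-perm = sym (+-identityʳ _) , σ-perm
outerAct-desc {n} c1 (m ∷ ν) i b (suc k) X R M b+k+i≡c1 (m≤M ∷ ν-nonincreasing) (s≤s |ν|≤k) top<X top≤n σ-perm =
  inv-eq , subst (IsPerm n) (sym word-eq) (proj₂ ih)
  where
    p = b + k
    σ = X ++ desc b (suc k) ++ R
    rest = jumpWord c1 (suc (suc i)) ν
    p+i+1≡c1 : p + suc i ≡ c1
    p+i+1≡c1 = trans (+-suc p i) (trans (cong (_+ i) (sym (+-suc b k))) b+k+i≡c1)
    p+1+m≤top : suc p + m ≤ b + suc k + M
    p+1+m≤top = ≤-trans (+-monoʳ-≤ (suc p) m≤M) (≤-reflexive (cong (_+ M) (sym (+-suc b k))))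
    row = swapVal-run c1 i b k m X R p+i+1≡c1 (All.map (≤-<-trans p+1+m≤top) top<X) (≤-trans p+1+m≤top top≤n) σ-perm
    X′ = X ∷ʳ (suc p + m)
    R′ = proj₁ row
    ih = outerAct-desc c1 ν (suc i) b k X′ R′ m p+i+1≡c1 ν-nonincreasing |ν|≤k
           (AllP.++⁺ (All.map (λ top<x → <-trans (n<1+n _) (≤-<-trans p+1+m≤top top<x)) top<X) (n<1+n _ ∷ []))
           (≤-trans (n≤1+n _) (≤-trans p+1+m≤top top≤n))
           (proj₂ (proj₂ (proj₂ row)))
    word-eq : applyAll swapVal (run c1 (suc i) m ++ rest) σ ≡ applyAll swapVal rest (X′ ++ desc b k ++ R′)
    word-eq = trans (applyAll-++ swapVal (run c1 (suc i) m) rest σ) (cong (applyAll swapVal rest) (proj₁ (proj₂ row)))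
    inv-eq : inv (applyAll swapVal (run c1 (suc i) m ++ rest) σ) ≡ inv σ + (m + sum ν)
    inv-eq = begin
      inv (applyAll swapVal (run c1 (suc i) m ++ rest) σ)   ≡⟨ cong inv word-eq ⟩
      inv (applyAll swapVal rest (X′ ++ desc b k ++ R′))    ≡⟨ proj₁ ih ⟩
      inv (X′ ++ desc b k ++ R′) + sum ν                    ≡⟨ cong (_+ sum ν) (proj₁ (proj₂ (proj₂ row))) ⟩
      (inv σ + m) + sum ν                                   ≡⟨ +-assoc (inv σ) m (sum ν) ⟩
      inv σ + (m + sum ν) ∎
      where open ≡-Reasoning

nonincreasing-∷ : ∀ {c} μ → Linked _≥_ μ → headLt μ c → Linked _≥_ (c ∷ μ)
nonincreasing-∷ [] _ _ = [-]
nonincreasing-∷ (m ∷ μ) μ-nonincreasing m<c = <⇒≤ m<c ∷ μ-nonincreasing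

length≤sum : ∀ xs → All (1 ≤_) xs → length xs ≤ sum xs
length≤sum [] [] = z≤n
length≤sum (x ∷ xs) (1≤x ∷ pos) = +-mono-≤ 1≤x (length≤sum xs pos)

innerAct-minPerm : ∀ c1 c2 μ d K → IsJumpPartition c1 c2 μ → length μ + (d + K) ≡ c1 →
  Σ (List ℕ) λ W →
    (innerAct c1 (minPerm c1 c2) μ ≡ desc (length μ + d) K ++ desc (length μ) d ++ W)
    × (inv (innerAct c1 (minPerm c1 c2) μ) ≡ inv (minPerm c1 c2) + sum μ)
innerAct-minPerm c1 c2 μ d K ((μ-nonincreasing , _) , _ , μ₁<c2) L+d+K≡c1 =
  W , trans moved split , trans (cong inv moved) (trans (proj₂ (proj₂ inner)) (cong (λ τ → inv τ + sum μ) (sym π≡)))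
  where
    L = length μ
    π≡ : minPerm c1 c2 ≡ desc 0 (L + (d + K)) ++ desc c1 c2 ++ []
    π≡ = cong₂ _++_ (cong (desc 0) (sym L+d+K≡c1)) (sym (++-identityʳ _))
    inner = innerAct-desc c1 μ 0 (d + K) (desc c1 c2) [] L+d+K≡c1
              (subst (λ l → Linked _≥_ (l ∷ μ)) (sym (length-desc c1 c2)) (nonincreasing-∷ μ μ-nonincreasing μ₁<c2))
              (desc-> c1 c2)
    W = proj₁ inner
    moved : innerAct c1 (minPerm c1 c2) μ ≡ desc L (d + K) ++ W
    moved = trans (cong (applyAll swapPos (jumpWord c1 1 μ)) π≡) (proj₁ (proj₂ inner))
    split : desc L (d + K) ++ W ≡ desc (L + d) K ++ desc L d ++ W
    split = trans (cong (_++ W) (desc-split L d K)) (++-assoc (desc (L + d) K) _ W)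

applyJump-minPerm : ∀ c1 c2 μ ν → IsJumpPartition c1 c2 μ → IsJumpPartition c1 c2 ν → length μ + length ν ≤ c1 →
  (inv (applyJump c1 μ ν (minPerm c1 c2)) ≡ inv (minPerm c1 c2) + (sum μ + sum ν))
  × IsPerm (c1 + c2) (applyJump c1 μ ν (minPerm c1 c2))
applyJump-minPerm c1 c2 μ ν μ-jump ((ν-nonincreasing , _) , _ , ν₁<c2) L+K≤c1 =
  inv-eq , subst (IsPerm (c1 + c2)) (cong (outerAct c1 ν) (sym σ≡)) (proj₂ outer)
  where
    L = length μ
    K = length ν
    d = proj₁ (m≤n⇒∃[o]m+o≡n L+K≤c1)
    L+d+K≡c1 : L + (d + K) ≡ c1
    L+d+K≡c1 = trans (cong (L +_) (+-comm d K)) (trans (sym (+-assoc L K d)) (proj₂ (m≤n⇒∃[o]m+o≡n L+K≤c1)))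
    π = minPerm c1 c2
    inner = innerAct-minPerm c1 c2 μ d K μ-jump L+d+K≡c1
    W = proj₁ inner
    σ = innerAct c1 π μ
    σ≡ : σ ≡ desc (L + d) K ++ desc L d ++ W
    σ≡ = proj₁ (proj₂ inner)
    σ-perm : IsPerm (c1 + c2) (desc (L + d) K ++ desc L d ++ W)
    σ-perm = subst (IsPerm (c1 + c2)) σ≡ (↭-trans (applyAll-swapPos-↭ (jumpWord c1 1 μ) π) (minPerm-isPerm c1 c2))
    outer = outerAct-desc c1 ν 0 (L + d) K [] (desc L d ++ W) c2
              (trans (+-identityʳ _) (trans (+-assoc L d K) L+d+K≡c1)) (nonincreasing-∷ ν ν-nonincreasing ν₁<c2)
              ≤-refl [] (≤-reflexive (cong (_+ c2) (trans (+-assoc L d K) L+d+K≡c1))) σ-perm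
    inv-eq : inv (outerAct c1 ν σ) ≡ inv π + (sum μ + sum ν)
    inv-eq = begin
      inv (outerAct c1 ν σ)                                  ≡⟨ cong (inv ∘ outerAct c1 ν) σ≡ ⟩
      inv (outerAct c1 ν (desc (L + d) K ++ desc L d ++ W))  ≡⟨ proj₁ outer ⟩
      inv (desc (L + d) K ++ desc L d ++ W) + sum ν          ≡⟨ cong (λ τ → inv τ + sum ν) σ≡ ⟨
      inv σ + sum ν                                          ≡⟨ cong (_+ sum ν) (proj₂ (proj₂ inner)) ⟩
      (inv π + sum μ) + sum ν                                ≡⟨ +-assoc (inv π) (sum μ) (sum ν) ⟩
      inv π + (sum μ + sum ν) ∎
      where open ≡-Reasoning

theorem19 : (n s r : ℕ) (λ' : List ℕ) → IsPartitionOf n λ' → conj λ' ≡ s ∷ r ∷ [] → r ≤ s → 1 ≤ r → (Δ : ℕ) → Δ < r → (c1 c2 : ℕ) → ((c1 ≡ s × c2 ≡ r) ⊎ (c1 ≡ r × c2 ≡ s)) → (μ ν : List ℕ) → IsJumpPartition c1 c2 μ → IsJumpPartition c1 c2 ν → sum μ + sum ν ≡ Δ → sh (applyJump c1 μ ν (minPerm c1 c2)) ≡ sh (minPerm c1 c2) → InW n λ' Δ (applyJump c1 μ ν (minPerm c1 c2))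
theorem19 n s r λ′ (λ′-partition , Σλ′≡n) conj≡ r≤s _ Δ Δ<r c1 c2 c1c2 μ ν μ-jump ν-jump |J|≡Δ valid =
  subst₂ (λ m κ → InW m κ Δ τ) size≡n sh≡λ′
    (proj₂ jump , valid , inv π , minPerm-isMinInv c1 c2 , trans (proj₁ jump) (cong (inv π +_) |J|≡Δ))
  where
    π = minPerm c1 c2
    τ = applyJump c1 μ ν π
    r≤c1 : r ≤ c1
    r≤c1 = [ (λ (c1≡s , _) → subst (r ≤_) (sym c1≡s) r≤s) , (λ (c1≡r , _) → ≤-reflexive (sym c1≡r)) ]′ c1c2
    sh≡λ′ : sh π ≡ λ′
    sh≡λ′ = trans (sh-minPerm c1 c2) (trans (columns-swap c1c2) (sym (conj≡⇒columns λ′ λ′-partition conj≡)))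
    size≡n : c1 + c2 ≡ n
    size≡n = trans (sym (sum-columns c1 c2)) (trans (cong sum (sym (sh-minPerm c1 c2))) (trans (cong sum sh≡λ′) Σλ′≡n))
    jump = applyJump-minPerm c1 c2 μ ν μ-jump ν-jump
      (≤-trans (+-mono-≤ (length≤sum μ (proj₂ (proj₁ μ-jump))) (length≤sum ν (proj₂ (proj₁ ν-jump))))
        (≤-trans (≤-reflexive |J|≡Δ) (≤-trans (<⇒≤ Δ<r) r≤c1)))
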